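{- Let $C$ be a sufficiently large absolute constant and let $G_1$ be a graph on at most $n$ nodes in which every node $v$ has a palette of size $p_{G_1}(v)\ge d_{G_1}(v)+1$. Let $L=\{v : p_{G_1}(v)<C\}$. Suppose each node $v$ joins a set $S$ with probability $d_{G_1}(v)^{ -0.1}$, where these random choices are determined by a hash function drawn uniformly at random from a $101$-wise independent family $[n^{O(1)}]\to[n^{O(1)}]$. Then every node $v\in G_1\setminus L$ fails or joins $S$ with probability at most $2d_{G_1}(v)^{ -0.1}$.
   Context: $N^{\approx}(v)$ is the set of neighbors $u$ of $v$ in $G_1$ with $\frac12 d_{G_1}(v)\le d_{G_1}(u)\le 6 d_{G_1}(v)$. Node $v$ is successful if at least one holds: $p_{G_1}(v)\ge 1.1 d_{G_1}(v)$; $|N^{\approx}(v)|\le\frac13 d_{G_1}(v)$; at least $\frac14 p_{G_1}(v)^{0.9}$ neighbors of $v$ join $S$. Otherwise $v$ fails. A family of hash functions is $k$-wise independent if the values $\{h(x)\}$ are $k$-wise independent when $h$ is uniform in the family. -}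

module Defs where

open import Data.Nat using (ℕ; zero; suc; _+_; _*_; _^_; _≤_; _<ᵇ_; _≤ᵇ_)
open import Data.Bool using (Bool; true; false; _∧_; _∨_; not; if_then_else_)
open import Data.Fin using (Fin; toℕ)
open import Data.List using (List; length; filter; allFin; sum; map)
open import Data.List.Relation.Unary.All using (All)
open import Relation.Binary.PropositionalEquality using (_≡_; _≢_)
open import Relation.Nullary.Decidable using (does)
open import Data.Bool.Properties using (T?)
open import Function.Definitions using (Injective)

record Graph (m : ℕ) : Set where
  field
    adj   : Fin m → Fin m → Bool
    sym   : ∀ u v → adj u v ≡ adj v u
    irref : ∀ v → adj v v ≡ false
open Graph public

countFin : {m : ℕ} → (Fin m → Bool) → ℕ
countFin {m} P = length (filter (λ x → T? (P x)) (allFin m))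

countList : {A : Set} → (A → Bool) → List A → ℕ
countList P xs = length (filter (λ x → T? (P x)) xs)

deg : {m : ℕ} → Graph m → Fin m → ℕ
deg G v = countFin (adj G v)

-- v joins S (under hash function h : [m] → [M]) iff h(v)/M < d(v)^{-0.1},
-- i.e. h(v)^10 * d(v) < M^10. (For d(v) = 0, d^{-0.1} = ∞: v always joins.)
joins : {m M : ℕ} → Graph m → (Fin m → Fin M) → Fin m → Bool
joins {M = M} G h v = (toℕ (h v) ^ 10) * deg G v <ᵇ (M ^ 10)

nApprox : {m : ℕ} → Graph m → Fin m → ℕ
nApprox G v = countFin (λ u → adj G v u ∧ (deg G v ≤ᵇ 2 * deg G u) ∧ (deg G u ≤ᵇ 6 * deg G v))

joiningNbrs : {m M : ℕ} → Graph m → (Fin m → Fin M) → Fin m → ℕ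
joiningNbrs G h v = countFin (λ u → adj G v u ∧ joins G h u)

-- v is successful (palette sizes p):
--   p(v) ≥ 1.1 d(v)                  ⇔ 11 d(v) ≤ 10 p(v)
--   |N≈(v)| ≤ d(v)/3                 ⇔ 3 |N≈(v)| ≤ d(v)
--   #joining nbrs ≥ p(v)^0.9 / 4     ⇔ p(v)^9 ≤ 4^10 * k^10
successful : {m M : ℕ} → Graph m → (Fin m → ℕ) → (Fin m → Fin M) → Fin m → Bool
successful G p h v =
  (11 * deg G v ≤ᵇ 10 * p v)
  ∨ (3 * nApprox G v ≤ᵇ deg G v)
  ∨ (p v ^ 9 ≤ᵇ (4 ^ 10) * (joiningNbrs G h v ^ 10))

failsOrJoins : {m M : ℕ} → Graph m → (Fin m → ℕ) → (Fin m → Fin M) → Fin m → Bool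
failsOrJoins G p h v = not (successful G p h v) ∨ joins G h v

-- k-wise independence of a (multi)set H of functions Fin m → Fin M, with h
-- uniform over H: for every j ≤ k, all distinct x₁..x_j and all y₁..y_j,
-- Pr[h(x_i) = y_i ∀ i] = M^{-j}, i.e. #{h | ...} * M^j = |H|.
agreesOn : {m M j : ℕ} → (Fin j → Fin m) → (Fin j → Fin M) → (Fin m → Fin M) → Bool
agreesOn {j = j} xs ys h =
  countFin (λ i → does (Data.Fin._≟_ (h (xs i)) (ys i))) Data.Nat.≡ᵇ j
  where import Data.Fin; import Data.Nat

KWiseIndependent : (k : ℕ) {m M : ℕ} → List (Fin m → Fin M) → Set
KWiseIndependent k {m} {M} H =
  ∀ (j : ℕ) → j ≤ k → (xs : Fin j → Fin m) → Injective _≡_ _≡_ xs →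
  (ys : Fin j → Fin M) → countList (agreesOn xs ys) H * M ^ j ≡ length H

-- Fix v and write d = d(v), N = |H|. Node v joins S iff h(v)^10 · d < M^10; these hash values
-- form an initial segment of length r, so Pr[v joins] = r/M with (r − 1)/M < d^(−0.1), and it
-- suffices to show Pr[v fails] ≤ (r − 2)/M. This is immediate when d ≤ 1 or when one of the first
-- two success conditions holds. Otherwise p(v) < 1.1 d, so p(v) ≥ C forces d ≥ 10⁶, and v has
-- s > d/3 neighbours u ∈ N^≈(v). Each of them joins S as soon as h(u)^10 · 6d < M^10, an event of
-- probability t/M ≈ (6d)^(−0.1), so the number X of such joining neighbours has mean s t / M ≳ d^0.9.
-- A failure leaves fewer than p(v)^0.9 / 4 joining neighbours, which forces X ≤ (44/45) E X.
-- Pairwise independence of H gives Var X ≤ E X, and Chebyshev bounds the failure probability by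
-- 2025 / E X ≤ (t − 2)/M ≤ (r − 2)/M.

module Submission where

open import Defs hiding (sym)
open import Data.Bool using (Bool; true; false; T; _∧_; _∨_; not)
open import Data.Bool.Properties using (T-∧; T-∨; T-not-≡)
open import Data.Empty using (⊥-elim)
open import Data.Fin using (Fin; zero; suc; toℕ; _≟_)
open import Data.Fin.Properties using (toℕ<n)
open import Data.List using (List; []; _∷_; length; allFin; tabulate)
open import Data.List.Properties using (length-filter; length-tabulate)
open import Data.Nat
  using (ℕ; zero; suc; _+_; _*_; _∸_; _^_; _≤_; _<_; z≤n; s≤s; z<s; _≤ᵇ_; _<ᵇ_; _≡ᵇ_; ∣_-_∣; NonZero; >-nonZero)
open import Data.Nat.Properties hiding (_≟_)
open import Data.Nat.Tactic.RingSolver using (solve-∀)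
open import Data.Product using (∃; _×_; _,_; proj₁; proj₂)
open import Data.Sum using (_⊎_; inj₁; inj₂; map₂)
open import Data.Unit using (tt)
open import Function using (_∘_)
open import Function.Bundles using (Equivalence)
open import Relation.Binary.PropositionalEquality
open import Relation.Nullary using (Dec; does; yes; no)

𝟙 : Bool → ℕ
𝟙 true  = 1
𝟙 false = 0

∑ : {A : Set} → List A → (A → ℕ) → ℕ
∑ []       f = 0
∑ (x ∷ xs) f = f x + ∑ xs f

infix 5 ∑
syntax ∑ xs (λ x → e) = ∑[ x ∈ xs ] e

countList≡∑𝟙 : {A : Set} (P : A → Bool) (xs : List A) → countList P xs ≡ ∑[ x ∈ xs ] 𝟙 (P x)
countList≡∑𝟙 P []       = refl
countList≡∑𝟙 P (x ∷ xs) with P x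
... | true  = cong suc (countList≡∑𝟙 P xs)
... | false = countList≡∑𝟙 P xs

𝟙² : ∀ b → 𝟙 b * 𝟙 b ≡ 𝟙 b
𝟙² true  = refl
𝟙² false = refl

𝟙-mono : ∀ {a b} → (T a → T b) → 𝟙 a ≤ 𝟙 b
𝟙-mono {false}         _   = z≤n
𝟙-mono {true} {true}  _   = ≤-refl
𝟙-mono {true} {false} a⇒b = ⊥-elim (a⇒b tt)

𝟙-∨ : ∀ a b → 𝟙 (a ∨ b) ≤ 𝟙 a + 𝟙 b
𝟙-∨ true  b = s≤s z≤n
𝟙-∨ false b = ≤-refl

𝟙-∧-mono : ∀ {a b c} → (T a → T b → T c) → 𝟙 a * 𝟙 b ≤ 𝟙 c
𝟙-∧-mono {false}                  _ = z≤n
𝟙-∧-mono {true} {false}           _ = z≤n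
𝟙-∧-mono {true} {true}  {true}    _ = ≤-refl
𝟙-∧-mono {true} {true}  {false} abc = ⊥-elim (abc tt tt)

module _ {A : Set} where

  ∑-cong : {f g : A → ℕ} (xs : List A) → (∀ x → f x ≡ g x) → ∑ xs f ≡ ∑ xs g
  ∑-cong []       f≡g = refl
  ∑-cong (x ∷ xs) f≡g = cong₂ _+_ (f≡g x) (∑-cong xs f≡g)

  ∑-mono-≤ : {f g : A → ℕ} (xs : List A) → (∀ x → f x ≤ g x) → ∑ xs f ≤ ∑ xs g
  ∑-mono-≤ []       f≤g = z≤n
  ∑-mono-≤ (x ∷ xs) f≤g = +-mono-≤ (f≤g x) (∑-mono-≤ xs f≤g)

  ∑-distrib-+ : (f g : A → ℕ) (xs : List A) → ∑[ x ∈ xs ] (f x + g x) ≡ ∑ xs f + ∑ xs g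
  ∑-distrib-+ f g []       = refl
  ∑-distrib-+ f g (x ∷ xs) rewrite ∑-distrib-+ f g xs = +-+-exchange (f x) (g x) (∑ xs f) (∑ xs g)
    where
    +-+-exchange : ∀ a b c d → (a + b) + (c + d) ≡ (a + c) + (b + d)
    +-+-exchange = solve-∀

  ∑-*ˡ : (c : ℕ) (f : A → ℕ) (xs : List A) → ∑[ x ∈ xs ] (c * f x) ≡ c * ∑ xs f
  ∑-*ˡ c f []       = sym (*-zeroʳ c)
  ∑-*ˡ c f (x ∷ xs) rewrite ∑-*ˡ c f xs = sym (*-distribˡ-+ c (f x) (∑ xs f))

  ∑-*ʳ : (c : ℕ) (f : A → ℕ) (xs : List A) → ∑[ x ∈ xs ] (f x * c) ≡ ∑ xs f * c
  ∑-*ʳ c f xs = trans (∑-cong xs (λ x → *-comm (f x) c)) (trans (∑-*ˡ c f xs) (*-comm c _))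

  ∑-const : (c : ℕ) (xs : List A) → ∑[ x ∈ xs ] c ≡ length xs * c
  ∑-const c []       = refl
  ∑-const c (x ∷ xs) = cong (c +_) (∑-const c xs)

  ∑-zero : (xs : List A) → ∑[ x ∈ xs ] 0 ≡ 0
  ∑-zero []       = refl
  ∑-zero (x ∷ xs) = ∑-zero xs

  ∑-*ʳ-cong : (c : ℕ) {f g : A → ℕ} (xs : List A) → (∀ x → f x * c ≡ g x) → ∑ xs f * c ≡ ∑ xs g
  ∑-*ʳ-cong c xs fc≡g = trans (sym (∑-*ʳ c _ xs)) (∑-cong xs fc≡g)

  
∑-comm : {A B : Set} (f : A → B → ℕ) (xs : List A) (ys : List B) →
  ∑[ x ∈ xs ] ∑[ y ∈ ys ] f x y ≡ ∑[ y ∈ ys ] ∑[ x ∈ xs ] f x y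
∑-comm f []       ys = sym (∑-zero ys)
∑-comm f (x ∷ xs) ys rewrite ∑-comm f xs ys = sym (∑-distrib-+ (f x) (λ y → ∑[ x ∈ xs ] f x y) ys)

∑-square : {A : Set} (f : A → ℕ) (xs : List A) → ∑ xs f * ∑ xs f ≡ ∑[ x ∈ xs ] ∑[ y ∈ xs ] f x * f y
∑-square f xs = trans (sym (∑-*ʳ (∑ xs f) f xs)) (∑-cong xs (λ x → sym (∑-*ˡ (f x) f xs)))

∑-tabulate : {B : Set} (n : ℕ) (f : B → ℕ) (g : Fin n → B) → ∑ (tabulate g) f ≡ ∑ (allFin n) (f ∘ g)
∑-tabulate zero    f g = refl
∑-tabulate (suc n) f g = cong (f (g zero) +_) (trans (∑-tabulate n f (g ∘ suc)) (sym (∑-tabulate n (f ∘ g) suc)))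

∑-allFin-suc : (n : ℕ) (f : Fin (suc n) → ℕ) → ∑ (allFin (suc n)) f ≡ f zero + (∑[ i ∈ allFin n ] f (suc i))
∑-allFin-suc n f = cong (f zero +_) (∑-tabulate n f suc)

_==_ : {M : ℕ} → Fin M → Fin M → Bool
y == z = does (y ≟ z)

∑-δ : (M : ℕ) (g : Fin M → ℕ) (z : Fin M) → ∑[ y ∈ allFin M ] 𝟙 (z == y) * g y ≡ g z
∑-δ (suc M) g zero = begin
    ∑[ y ∈ allFin (suc M) ] 𝟙 (zero == y) * g y
  ≡⟨ ∑-allFin-suc M (λ y → 𝟙 (zero == y) * g y) ⟩
    g zero + 0 + (∑[ y ∈ allFin M ] 0)
  ≡⟨ cong₂ _+_ (+-identityʳ (g zero)) (∑-zero (allFin M)) ⟩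
    g zero + 0
  ≡⟨ +-identityʳ (g zero) ⟩
    g zero ∎
  where open ≡-Reasoning
∑-δ (suc M) g (suc z) =
  trans (∑-allFin-suc M (λ y → 𝟙 (suc z == y) * g y)) (∑-δ M (g ∘ suc) z)

∑𝟙-allFin-≤ : (M : ℕ) (P : Fin M → Bool) (b : ℕ) →
  (∀ y → T (P y) → toℕ y < b) → ∑[ y ∈ allFin M ] 𝟙 (P y) ≤ b
∑𝟙-allFin-≤ zero P b below = z≤n
∑𝟙-allFin-≤ (suc M) P b below rewrite ∑-allFin-suc M (𝟙 ∘ P) with P zero in P0
... | false = ∑𝟙-allFin-≤ M (P ∘ suc) b (λ y Py → <-trans (n<1+n _) (below (suc y) Py))
∑𝟙-allFin-≤ (suc M) P zero below    | true with () ← below zero (subst T (sym P0) tt)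
∑𝟙-allFin-≤ (suc M) P (suc b) below | true =
  s≤s (∑𝟙-allFin-≤ M (P ∘ suc) b (λ y Py → ≤-pred (below (suc y) Py)))

∑𝟙-allFin-≥ : (M : ℕ) (P : Fin M → Bool) (b : ℕ) → b ≤ M →
  (∀ y → toℕ y < b → T (P y)) → b ≤ ∑[ y ∈ allFin M ] 𝟙 (P y)
∑𝟙-allFin-≥ M P zero b≤M above = z≤n
∑𝟙-allFin-≥ (suc M) P (suc b) (s≤s b≤M) above rewrite ∑-allFin-suc M (𝟙 ∘ P) with P zero | above zero z<s
... | true | _ = s≤s (∑𝟙-allFin-≥ M (P ∘ suc) b b≤M (λ y y<b → above (suc y) (s≤s y<b)))

-- Evaluating a k-wise independent family at one or two points

agreesOn₁ : {m M : ℕ} (xs : Fin 1 → Fin m) (ys : Fin 1 → Fin M) (h : Fin m → Fin M) →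
  agreesOn xs ys h ≡ (h (xs zero) == ys zero)
agreesOn₁ xs ys h =
  trans (cong (_≡ᵇ 1) (countList≡∑𝟙 (λ i → h (xs i) == ys i) (allFin 1))) (one (h (xs zero) == ys zero))
  where
  one : ∀ a → (𝟙 a + 0 ≡ᵇ 1) ≡ a
  one true  = refl
  one false = refl

agreesOn₂ : {m M : ℕ} (xs : Fin 2 → Fin m) (ys : Fin 2 → Fin M) (h : Fin m → Fin M) →
  agreesOn xs ys h ≡ (h (xs zero) == ys zero ∧ h (xs (suc zero)) == ys (suc zero))
agreesOn₂ xs ys h =
  trans (cong (_≡ᵇ 2) (countList≡∑𝟙 (λ i → h (xs i) == ys i) (allFin 2)))
        (both (h (xs zero) == ys zero) (h (xs (suc zero)) == ys (suc zero)))
  where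
  both : ∀ a b → (𝟙 a + (𝟙 b + 0) ≡ᵇ 2) ≡ a ∧ b
  both true  true  = refl
  both true  false = refl
  both false true  = refl
  both false false = refl

∑-fibres : {A : Set} {M : ℕ} (xs : List A) (φ : A → Fin M) (f : Fin M → ℕ) (g : A → ℕ) →
  ∑[ x ∈ xs ] f (φ x) * g x ≡ ∑[ y ∈ allFin M ] f y * (∑[ x ∈ xs ] 𝟙 (φ x == y) * g x)
∑-fibres {M = M} xs φ f g = sym (begin
    ∑[ y ∈ allFin M ] f y * (∑[ x ∈ xs ] 𝟙 (φ x == y) * g x)
  ≡⟨ ∑-cong (allFin M) (λ y → sym (∑-*ˡ (f y) _ xs)) ⟩
    ∑[ y ∈ allFin M ] ∑[ x ∈ xs ] f y * (𝟙 (φ x == y) * g x)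
  ≡⟨ ∑-comm _ (allFin M) xs ⟩
    ∑[ x ∈ xs ] ∑[ y ∈ allFin M ] f y * (𝟙 (φ x == y) * g x)
  ≡⟨ ∑-cong xs (λ x → ∑-cong (allFin M) (λ y → swap (f y) (𝟙 (φ x == y)) (g x))) ⟩
    ∑[ x ∈ xs ] ∑[ y ∈ allFin M ] 𝟙 (φ x == y) * (f y * g x)
  ≡⟨ ∑-cong xs (λ x → ∑-δ M (λ y → f y * g x) (φ x)) ⟩
    ∑[ x ∈ xs ] f (φ x) * g x ∎)
  where
  open ≡-Reasoning
  swap : ∀ a b c → a * (b * c) ≡ b * (a * c)
  swap = solve-∀

module _ {m M : ℕ} (H : List (Fin m → Fin M)) (indep : KWiseIndependent 101 H) where

  ∑-hits : (u : Fin m) (y : Fin M) → (∑[ h ∈ H ] 𝟙 (h u == y)) * M ≡ length H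
  ∑-hits u y = begin
      (∑[ h ∈ H ] 𝟙 (h u == y)) * M
    ≡⟨ cong₂ _*_ (trans (∑-cong H (λ h → cong 𝟙 (sym (agreesOn₁ xs ys h)))) (sym (countList≡∑𝟙 _ H)))
                 (sym (*-identityʳ M)) ⟩
      countList (agreesOn xs ys) H * M ^ 1
    ≡⟨ indep 1 (s≤s z≤n) xs xs-injective ys ⟩
      length H ∎
    where
    open ≡-Reasoning
    xs : Fin 1 → Fin m
    xs _ = u
    ys : Fin 1 → Fin M
    ys _ = y
    xs-injective : ∀ {i j} → xs i ≡ xs j → i ≡ j
    xs-injective {zero} {zero} _ = refl

  ∑-hits₂ : {u w : Fin m} → u ≢ w → (a b : Fin M) →
    (∑[ h ∈ H ] 𝟙 (h u == a) * 𝟙 (h w == b)) * (M * M) ≡ length H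
  ∑-hits₂ {u} {w} u≢w a b = begin
      (∑[ h ∈ H ] 𝟙 (h u == a) * 𝟙 (h w == b)) * (M * M)
    ≡⟨ cong₂ _*_ (trans (∑-cong H (λ h → 𝟙-∧ (h u == a) (h w == b) (sym (agreesOn₂ xs ys h))))
                        (sym (countList≡∑𝟙 _ H)))
                 (cong (M *_) (sym (*-identityʳ M))) ⟩
      countList (agreesOn xs ys) H * M ^ 2
    ≡⟨ indep 2 (s≤s (s≤s z≤n)) xs xs-injective ys ⟩
      length H ∎
    where
    open ≡-Reasoning
    xs : Fin 2 → Fin m
    xs zero    = u
    xs (suc _) = w
    ys : Fin 2 → Fin M
    ys zero    = a
    ys (suc _) = b
    xs-injective : ∀ {i j} → xs i ≡ xs j → i ≡ j
    xs-injective {zero}     {zero}     _ = refl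
    xs-injective {zero}     {suc zero} e = ⊥-elim (u≢w e)
    xs-injective {suc zero} {zero}     e = ⊥-elim (u≢w (sym e))
    xs-injective {suc zero} {suc zero} _ = refl
    𝟙-∧ : ∀ x y {z} → (x ∧ y) ≡ z → 𝟙 x * 𝟙 y ≡ 𝟙 z
    𝟙-∧ true  true  refl = refl
    𝟙-∧ true  false refl = refl
    𝟙-∧ false y     refl = refl

  ∑-eval : (u : Fin m) (f : Fin M → ℕ) → (∑[ h ∈ H ] f (h u)) * M ≡ length H * (∑[ y ∈ allFin M ] f y)
  ∑-eval u f = begin
      (∑[ h ∈ H ] f (h u)) * M
    ≡⟨ cong (_* M) (trans (∑-cong H (λ h → sym (*-identityʳ (f (h u))))) (∑-fibres H (λ h → h u) f (λ _ → 1))) ⟩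
      (∑[ y ∈ allFin M ] f y * (∑[ h ∈ H ] 𝟙 (h u == y) * 1)) * M
    ≡⟨ ∑-*ʳ-cong M (allFin M) (λ y → trans (*-assoc (f y) _ M) (cong (f y *_) (hits y))) ⟩
      ∑[ y ∈ allFin M ] f y * length H
    ≡⟨ trans (∑-*ʳ (length H) f (allFin M)) (*-comm _ (length H)) ⟩
      length H * (∑[ y ∈ allFin M ] f y) ∎
    where
    open ≡-Reasoning
    hits : ∀ y → (∑[ h ∈ H ] 𝟙 (h u == y) * 1) * M ≡ length H
    hits y = trans (cong (_* M) (∑-cong H (λ h → *-identityʳ _))) (∑-hits u y)

  ∑-eval₂ : {u w : Fin m} → u ≢ w → (f g : Fin M → ℕ) →
    (∑[ h ∈ H ] f (h u) * g (h w)) * (M * M) ≡ length H * ((∑[ y ∈ allFin M ] f y) * (∑[ y ∈ allFin M ] g y))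
  ∑-eval₂ {u} {w} u≢w f g = begin
      (∑[ h ∈ H ] f (h u) * g (h w)) * (M * M)
    ≡⟨ cong (_* (M * M)) (∑-fibres H (λ h → h u) f (λ h → g (h w))) ⟩
      (∑[ a ∈ allFin M ] f a * (∑[ h ∈ H ] 𝟙 (h u == a) * g (h w))) * (M * M)
    ≡⟨ ∑-*ʳ-cong (M * M) (allFin M) (λ a → trans (*-assoc (f a) _ (M * M)) (cong (f a *_) (fibre a))) ⟩
      ∑[ a ∈ allFin M ] f a * (length H * Σg)
    ≡⟨ ∑-*ʳ (length H * Σg) f (allFin M) ⟩
      Σf * (length H * Σg)
    ≡⟨ rearrange Σf (length H) Σg ⟩
      length H * (Σf * Σg) ∎
    where
    open ≡-Reasoning
    Σf Σg : ℕ
    Σf = ∑[ y ∈ allFin M ] f y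
    Σg = ∑[ y ∈ allFin M ] g y
    rearrange : ∀ a n b → a * (n * b) ≡ n * (a * b)
    rearrange = solve-∀
    fibre : ∀ a → (∑[ h ∈ H ] 𝟙 (h u == a) * g (h w)) * (M * M) ≡ length H * Σg
    fibre a = begin
        (∑[ h ∈ H ] 𝟙 (h u == a) * g (h w)) * (M * M)
      ≡⟨ cong (_* (M * M)) (trans (∑-cong H (λ h → *-comm (𝟙 (h u == a)) _))
                                  (∑-fibres H (λ h → h w) g (λ h → 𝟙 (h u == a)))) ⟩
        (∑[ b ∈ allFin M ] g b * (∑[ h ∈ H ] 𝟙 (h w == b) * 𝟙 (h u == a))) * (M * M)
      ≡⟨ ∑-*ʳ-cong (M * M) (allFin M) (λ b → trans (*-assoc (g b) _ (M * M))
                                          (cong (g b *_) (∑-hits₂ (λ w≡u → u≢w (sym w≡u)) b a))) ⟩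
        ∑[ b ∈ allFin M ] g b * length H
      ≡⟨ trans (∑-*ʳ (length H) g (allFin M)) (*-comm Σg (length H)) ⟩
        length H * Σg ∎

-- Chebyshev's inequality

m≤n⇒m²+n²≡2mn+∣m-n∣² : ∀ {m n} → m ≤ n → m * m + n * n ≡ 2 * m * n + ∣ m - n ∣ * ∣ m - n ∣
m≤n⇒m²+n²≡2mn+∣m-n∣² {m} {n} m≤n =
  subst (λ n → m * m + n * n ≡ 2 * m * n + ∣ m - n ∣ * ∣ m - n ∣) (m+[n∸m]≡n m≤n)
    (trans (identity m (n ∸ m)) (cong (λ e → 2 * m * (m + (n ∸ m)) + e * e) (sym (∣m-m+n∣≡n m (n ∸ m)))))
  where
  identity : ∀ a k → a * a + (a + k) * (a + k) ≡ 2 * a * (a + k) + k * k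
  identity = solve-∀

m²+n²≡2mn+∣m-n∣² : ∀ m n → m * m + n * n ≡ 2 * m * n + ∣ m - n ∣ * ∣ m - n ∣
m²+n²≡2mn+∣m-n∣² m n with ≤-total m n
... | inj₁ m≤n = m≤n⇒m²+n²≡2mn+∣m-n∣² m≤n
... | inj₂ n≤m = begin
    m * m + n * n
  ≡⟨ +-comm (m * m) (n * n) ⟩
    n * n + m * m
  ≡⟨ m≤n⇒m²+n²≡2mn+∣m-n∣² n≤m ⟩
    2 * n * m + ∣ n - m ∣ * ∣ n - m ∣
  ≡⟨ cong₂ _+_ (swap n m) (cong₂ _*_ (∣-∣-comm n m) (∣-∣-comm n m)) ⟩
    2 * m * n + ∣ m - n ∣ * ∣ m - n ∣ ∎
  where
  open ≡-Reasoning
  swap : ∀ a b → 2 * a * b ≡ 2 * b * a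
  swap = solve-∀

≤-*-∣-∣ : ∀ k z μ → suc k * z ≤ k * μ → μ ≤ suc k * ∣ z - μ ∣
≤-*-∣-∣ k z μ kz≤kμ = begin
    μ
  ≡⟨ sym (m+n∸n≡m μ (k * μ)) ⟩
    suc k * μ ∸ k * μ
  ≤⟨ ∸-monoʳ-≤ (suc k * μ) kz≤kμ ⟩
    suc k * μ ∸ suc k * z
  ≡⟨ sym (*-distribˡ-∸ (suc k) μ z) ⟩
    suc k * (μ ∸ z)
  ≤⟨ *-monoʳ-≤ (suc k) (≤-trans (m∸n≤∣m-n∣ μ z) (≤-reflexive (∣-∣-comm μ z))) ⟩
    suc k * ∣ z - μ ∣ ∎
  where open ≤-Reasoning

module _ {A : Set} (xs : List A) (Z : A → ℕ) (μ : ℕ) where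

  ∑-dev² : (∑[ x ∈ xs ] ∣ Z x - μ ∣ * ∣ Z x - μ ∣) + 2 * μ * ∑ xs Z
         ≡ (∑[ x ∈ xs ] Z x * Z x) + length xs * (μ * μ)
  ∑-dev² = begin
      (∑[ x ∈ xs ] ∣ Z x - μ ∣ * ∣ Z x - μ ∣) + 2 * μ * ∑ xs Z
    ≡⟨ cong ((∑[ x ∈ xs ] ∣ Z x - μ ∣ * ∣ Z x - μ ∣) +_) (sym (∑-*ˡ (2 * μ) Z xs)) ⟩
      (∑[ x ∈ xs ] ∣ Z x - μ ∣ * ∣ Z x - μ ∣) + (∑[ x ∈ xs ] 2 * μ * Z x)
    ≡⟨ sym (∑-distrib-+ _ _ xs) ⟩
      ∑[ x ∈ xs ] (∣ Z x - μ ∣ * ∣ Z x - μ ∣ + 2 * μ * Z x)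
    ≡⟨ ∑-cong xs (λ x → sym (trans (m²+n²≡2mn+∣m-n∣² (Z x) μ) (swap (Z x) μ _))) ⟩
      ∑[ x ∈ xs ] (Z x * Z x + μ * μ)
    ≡⟨ trans (∑-distrib-+ _ _ xs) (cong ((∑[ x ∈ xs ] Z x * Z x) +_) (∑-const (μ * μ) xs)) ⟩
      (∑[ x ∈ xs ] Z x * Z x) + length xs * (μ * μ) ∎
    where
    open ≡-Reasoning
    swap : ∀ z μ d → 2 * z * μ + d ≡ d + 2 * μ * z
    swap = solve-∀

  chebyshev : (k : ℕ) (P : A → Bool) → (∀ x → T (P x) → suc k * Z x ≤ k * μ) →
    (∑[ x ∈ xs ] 𝟙 (P x)) * (μ * μ) ≤ suc k * suc k * (∑[ x ∈ xs ] ∣ Z x - μ ∣ * ∣ Z x - μ ∣)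
  chebyshev k P far = begin
      (∑[ x ∈ xs ] 𝟙 (P x)) * (μ * μ)
    ≡⟨ sym (∑-*ʳ (μ * μ) _ xs) ⟩
      ∑[ x ∈ xs ] 𝟙 (P x) * (μ * μ)
    ≤⟨ ∑-mono-≤ xs pointwise ⟩
      ∑[ x ∈ xs ] suc k * suc k * (∣ Z x - μ ∣ * ∣ Z x - μ ∣)
    ≡⟨ ∑-*ˡ (suc k * suc k) _ xs ⟩
      suc k * suc k * (∑[ x ∈ xs ] ∣ Z x - μ ∣ * ∣ Z x - μ ∣) ∎
    where
    open ≤-Reasoning
    swap : ∀ a b → a * b * (a * b) ≡ a * a * (b * b)
    swap = solve-∀
    pointwise : ∀ x → 𝟙 (P x) * (μ * μ) ≤ suc k * suc k * (∣ Z x - μ ∣ * ∣ Z x - μ ∣)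
    pointwise x with P x in Px
    ... | false = z≤n
    ... | true  = begin
        μ * μ + 0
      ≡⟨ +-identityʳ (μ * μ) ⟩
        μ * μ
      ≤⟨ *-mono-≤ μ≤ μ≤ ⟩
        suc k * ∣ Z x - μ ∣ * (suc k * ∣ Z x - μ ∣)
      ≡⟨ swap (suc k) ∣ Z x - μ ∣ ⟩
        suc k * suc k * (∣ Z x - μ ∣ * ∣ Z x - μ ∣) ∎
      where
      μ≤ : μ ≤ suc k * ∣ Z x - μ ∣
      μ≤ = ≤-*-∣-∣ k (Z x) μ (far x (subst T (sym Px) tt))

-- X h counts the u ∈ B with h u ∈ Q; E X = s t / M, and Var X ≤ E X by pairwise independence.
module HitCount {m M : ℕ} (H : List (Fin m → Fin M)) (indep : KWiseIndependent 101 H)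
                (B : Fin m → Bool) (Q : Fin M → Bool) where

  N s t : ℕ
  N = length H
  s = ∑[ u ∈ allFin m ] 𝟙 (B u)
  t = ∑[ y ∈ allFin M ] 𝟙 (Q y)

  X : (Fin m → Fin M) → ℕ
  X h = ∑[ u ∈ allFin m ] 𝟙 (B u) * 𝟙 (Q (h u))

  ∑X : (∑[ h ∈ H ] X h) * M ≡ s * (N * t)
  ∑X = begin
      (∑[ h ∈ H ] X h) * M
    ≡⟨ cong (_* M) (∑-comm _ H (allFin m)) ⟩
      (∑[ u ∈ allFin m ] ∑[ h ∈ H ] 𝟙 (B u) * 𝟙 (Q (h u))) * M
    ≡⟨ ∑-*ʳ-cong M (allFin m) (λ u → trans (cong (_* M) (∑-*ˡ (𝟙 (B u)) (λ h → 𝟙 (Q (h u))) H))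
         (trans (*-assoc (𝟙 (B u)) _ M) (cong (𝟙 (B u) *_) (∑-eval H indep u (𝟙 ∘ Q))))) ⟩
      ∑[ u ∈ allFin m ] 𝟙 (B u) * (N * t)
    ≡⟨ ∑-*ʳ (N * t) (𝟙 ∘ B) (allFin m) ⟩
      s * (N * t) ∎
    where open ≡-Reasoning

  co-hits : Fin m → Fin m → ℕ
  co-hits u w = ∑[ h ∈ H ] 𝟙 (Q (h u)) * 𝟙 (Q (h w))

  co-hits-bound : ∀ u w → 𝟙 (B u) * 𝟙 (B w) * co-hits u w * (M * M)
                        ≤ 𝟙 (B u) * (𝟙 (u == w) * (M * (N * t)) + 𝟙 (B w) * (N * (t * t)))
  co-hits-bound u w with u ≟ w
  ... | yes refl = begin
      𝟙 (B u) * 𝟙 (B u) * co-hits u u * (M * M)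
    ≡⟨ cong₂ (λ a c → a * c * (M * M)) (𝟙² (B u)) (∑-cong H (λ h → 𝟙² (Q (h u)))) ⟩
      𝟙 (B u) * (∑[ h ∈ H ] 𝟙 (Q (h u))) * (M * M)
    ≡⟨ reassoc (𝟙 (B u)) _ M ⟩
      𝟙 (B u) * ((∑[ h ∈ H ] 𝟙 (Q (h u))) * M * M)
    ≡⟨ cong (λ e → 𝟙 (B u) * (e * M)) (∑-eval H indep u (𝟙 ∘ Q)) ⟩
      𝟙 (B u) * (N * t * M)
    ≤⟨ *-monoʳ-≤ (𝟙 (B u)) (≤-trans (≤-reflexive (trans (*-comm (N * t) M) (sym (+-identityʳ _)))) (m≤m+n _ _)) ⟩
      𝟙 (B u) * (1 * (M * (N * t)) + 𝟙 (B u) * (N * (t * t))) ∎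
    where
    open ≤-Reasoning
    reassoc : ∀ b x M → b * x * (M * M) ≡ b * (x * M * M)
    reassoc = solve-∀
  ... | no u≢w = begin
      𝟙 (B u) * 𝟙 (B w) * co-hits u w * (M * M)
    ≡⟨ *-assoc (𝟙 (B u) * 𝟙 (B w)) _ _ ⟩
      𝟙 (B u) * 𝟙 (B w) * (co-hits u w * (M * M))
    ≡⟨ cong (𝟙 (B u) * 𝟙 (B w) *_) (∑-eval₂ H indep u≢w (𝟙 ∘ Q) (𝟙 ∘ Q)) ⟩
      𝟙 (B u) * 𝟙 (B w) * (N * (t * t))
    ≡⟨ *-assoc (𝟙 (B u)) _ _ ⟩
      𝟙 (B u) * (0 * (M * (N * t)) + 𝟙 (B w) * (N * (t * t))) ∎
    where open ≤-Reasoning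

  ∑X² : (∑[ h ∈ H ] X h * X h) * (M * M) ≤ s * (M * (N * t) + s * (N * (t * t)))
  ∑X² = begin
      (∑[ h ∈ H ] X h * X h) * (M * M)
    ≡⟨ cong (_* (M * M)) expand ⟩
      (∑[ u ∈ allFin m ] ∑[ w ∈ allFin m ] 𝟙 (B u) * 𝟙 (B w) * co-hits u w) * (M * M)
    ≡⟨ sym (∑-*ʳ (M * M) _ (allFin m)) ⟩
      ∑[ u ∈ allFin m ] (∑[ w ∈ allFin m ] 𝟙 (B u) * 𝟙 (B w) * co-hits u w) * (M * M)
    ≡⟨ ∑-cong (allFin m) (λ u → sym (∑-*ʳ (M * M) _ (allFin m))) ⟩
      ∑[ u ∈ allFin m ] ∑[ w ∈ allFin m ] 𝟙 (B u) * 𝟙 (B w) * co-hits u w * (M * M)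
    ≤⟨ ∑-mono-≤ (allFin m) (λ u → ∑-mono-≤ (allFin m) (co-hits-bound u)) ⟩
      ∑[ u ∈ allFin m ] ∑[ w ∈ allFin m ] 𝟙 (B u) * (𝟙 (u == w) * (M * (N * t)) + 𝟙 (B w) * (N * (t * t)))
    ≡⟨ ∑-cong (allFin m) (λ u → trans (∑-*ˡ (𝟙 (B u)) _ (allFin m)) (cong (𝟙 (B u) *_) (inner u))) ⟩
      ∑[ u ∈ allFin m ] 𝟙 (B u) * (M * (N * t) + s * (N * (t * t)))
    ≡⟨ ∑-*ʳ _ (𝟙 ∘ B) (allFin m) ⟩
      s * (M * (N * t) + s * (N * (t * t))) ∎
    where
    open ≤-Reasoning
    shuffle : ∀ a b c d → a * b * (c * d) ≡ a * c * (b * d)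
    shuffle = solve-∀
    expand : ∑[ h ∈ H ] X h * X h
           ≡ ∑[ u ∈ allFin m ] ∑[ w ∈ allFin m ] 𝟙 (B u) * 𝟙 (B w) * co-hits u w
    expand = begin-equality
        ∑[ h ∈ H ] X h * X h
      ≡⟨ ∑-cong H (λ h → ∑-square _ (allFin m)) ⟩
        ∑[ h ∈ H ] ∑[ u ∈ allFin m ] ∑[ w ∈ allFin m ] 𝟙 (B u) * 𝟙 (Q (h u)) * (𝟙 (B w) * 𝟙 (Q (h w)))
      ≡⟨ ∑-comm _ H (allFin m) ⟩
        ∑[ u ∈ allFin m ] ∑[ h ∈ H ] ∑[ w ∈ allFin m ] 𝟙 (B u) * 𝟙 (Q (h u)) * (𝟙 (B w) * 𝟙 (Q (h w)))
      ≡⟨ ∑-cong (allFin m) (λ u → ∑-comm _ H (allFin m)) ⟩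
        ∑[ u ∈ allFin m ] ∑[ w ∈ allFin m ] ∑[ h ∈ H ] 𝟙 (B u) * 𝟙 (Q (h u)) * (𝟙 (B w) * 𝟙 (Q (h w)))
      ≡⟨ ∑-cong (allFin m) (λ u → ∑-cong (allFin m) (λ w →
           trans (∑-cong H (λ h → shuffle (𝟙 (B u)) (𝟙 (Q (h u))) (𝟙 (B w)) (𝟙 (Q (h w)))))
                 (∑-*ˡ (𝟙 (B u) * 𝟙 (B w)) _ H))) ⟩
        ∑[ u ∈ allFin m ] ∑[ w ∈ allFin m ] 𝟙 (B u) * 𝟙 (B w) * co-hits u w ∎
    inner : ∀ u → ∑[ w ∈ allFin m ] (𝟙 (u == w) * (M * (N * t)) + 𝟙 (B w) * (N * (t * t)))
                ≡ M * (N * t) + s * (N * (t * t))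
    inner u = trans (∑-distrib-+ _ _ (allFin m))
      (cong₂ _+_ (∑-δ m (λ _ → M * (N * t)) u) (∑-*ʳ (N * (t * t)) (𝟙 ∘ B) (allFin m)))

  ∑-dev²-MX : ∑[ h ∈ H ] ∣ M * X h - s * t ∣ * ∣ M * X h - s * t ∣ ≤ s * (M * (N * t))
  ∑-dev²-MX = +-cancelʳ-≤ _ _ _ (begin
      (∑[ h ∈ H ] ∣ M * X h - s * t ∣ * ∣ M * X h - s * t ∣) + 2 * (s * t) * (∑[ h ∈ H ] M * X h)
    ≡⟨ ∑-dev² H (λ h → M * X h) (s * t) ⟩
      (∑[ h ∈ H ] M * X h * (M * X h)) + N * (s * t * (s * t))
    ≡⟨ cong (_+ N * (s * t * (s * t))) (trans (∑-cong H (λ h → square M (X h))) (∑-*ʳ (M * M) _ H)) ⟩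
      (∑[ h ∈ H ] X h * X h) * (M * M) + N * (s * t * (s * t))
    ≤⟨ +-monoˡ-≤ _ ∑X² ⟩
      s * (M * (N * t) + s * (N * (t * t))) + N * (s * t * (s * t))
    ≡⟨ rearrange s M N t ⟩
      s * (M * (N * t)) + 2 * (s * t) * (s * (N * t))
    ≡⟨ cong (λ e → s * (M * (N * t)) + 2 * (s * t) * e) (trans (sym ∑X) (trans (*-comm _ M) (sym (∑-*ˡ M X H)))) ⟩
      s * (M * (N * t)) + 2 * (s * t) * (∑[ h ∈ H ] M * X h) ∎)
    where
    open ≤-Reasoning
    square : ∀ M x → M * x * (M * x) ≡ x * x * (M * M)
    square = solve-∀
    rearrange : ∀ s M N t → s * (M * (N * t) + s * (N * (t * t))) + N * (s * t * (s * t))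
                         ≡ s * (M * (N * t)) + 2 * (s * t) * (s * (N * t))
    rearrange = solve-∀

  -- Chebyshev: Pr[X ≤ (44/45) E X] ≤ 45² Var X / (E X)² ≤ 2025 / E X.
  concentration : (P : (Fin m → Fin M) → Bool) → 0 < s * t →
    (∀ h → T (P h) → 45 * (M * X h) ≤ 44 * (s * t)) →
    (∑[ h ∈ H ] 𝟙 (P h)) * (s * t) ≤ 2025 * (M * N)
  concentration P st>0 far = *-cancelʳ-≤ _ _ (s * t) {{>-nonZero st>0}} (begin
      (∑[ h ∈ H ] 𝟙 (P h)) * (s * t) * (s * t)
    ≡⟨ *-assoc (∑[ h ∈ H ] 𝟙 (P h)) (s * t) (s * t) ⟩
      (∑[ h ∈ H ] 𝟙 (P h)) * (s * t * (s * t))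
    ≤⟨ chebyshev H (λ h → M * X h) (s * t) 44 P far ⟩
      45 * 45 * (∑[ h ∈ H ] ∣ M * X h - s * t ∣ * ∣ M * X h - s * t ∣)
    ≤⟨ *-monoʳ-≤ (45 * 45) ∑-dev²-MX ⟩
      45 * 45 * (s * (M * (N * t)))
    ≡⟨ rearrange s M N t ⟩
      2025 * (M * N) * (s * t) ∎)
    where
    open ≤-Reasoning
    rearrange : ∀ s M N t → 45 * 45 * (s * (M * (N * t))) ≡ 2025 * (M * N) * (s * t)
    rearrange = solve-∀

-- Hash values below a threshold

-- hashBelow D y says y / M < D^(−0.1); joins G h v is hashBelow (deg G v) (h v).
hashBelow : {M : ℕ} → ℕ → Fin M → Bool
hashBelow {M} D y = toℕ y ^ 10 * D <ᵇ M ^ 10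

#hashBelow : (M D : ℕ) → ℕ
#hashBelow M D = ∑[ y ∈ allFin M ] 𝟙 (hashBelow D y)

hashBelow-antitone : ∀ {M D D′} {y : Fin M} → D ≤ D′ → T (hashBelow D′ y) → T (hashBelow D y)
hashBelow-antitone {M} {D} {D′} {y} D≤D′ below =
  <⇒<ᵇ (≤-<-trans (*-monoʳ-≤ (toℕ y ^ 10) D≤D′) (<ᵇ⇒< (toℕ y ^ 10 * D′) (M ^ 10) below))

#hashBelow-antitone : ∀ M {D D′} → D ≤ D′ → #hashBelow M D′ ≤ #hashBelow M D
#hashBelow-antitone M {D} {D′} D≤D′ =
  ∑-mono-≤ (allFin M) (λ y → 𝟙-mono (hashBelow-antitone {M} {D} {D′} {y} D≤D′))

#hashBelow≤M : ∀ M D → #hashBelow M D ≤ M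
#hashBelow≤M M D = ∑𝟙-allFin-≤ M (hashBelow D) M (λ y _ → toℕ<n y)

#hashBelow-≥ : ∀ M D b → suc b ≤ M → b ^ 10 * D < M ^ 10 → suc b ≤ #hashBelow M D
#hashBelow-≥ M D b b<M below = ∑𝟙-allFin-≥ M (hashBelow D) (suc b) b<M
  (λ y y≤b → <⇒<ᵇ (≤-<-trans (*-monoˡ-≤ D (^-monoˡ-≤ 10 (≤-pred y≤b))) below))

#hashBelow-last : ∀ M D → 0 < #hashBelow M D → (#hashBelow M D ∸ 1) ^ 10 * D < M ^ 10
#hashBelow-last M D r>0 with (#hashBelow M D ∸ 1) ^ 10 * D <? M ^ 10
... | yes below = below
... | no ¬below = ⊥-elim (<⇒≱ (∸-monoʳ-< z<s r>0) (∑𝟙-allFin-≤ M (hashBelow D) _ lies-below))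
  where
  lies-below : ∀ y → T (hashBelow D y) → toℕ y < #hashBelow M D ∸ 1
  lies-below y below = ≰⇒> (λ last≤y → <⇒≱ (*-cancelʳ-< _ _ _ (<-≤-trans (<ᵇ⇒< _ _ below) (≮⇒≥ ¬below)))
                                           (^-monoˡ-≤ 10 last≤y))

#hashBelow-large : ∀ M D → 0 < D → M ^ 10 ≤ #hashBelow M D ^ 10 * D
#hashBelow-large M D D>0 with M ^ 10 ≤? #hashBelow M D ^ 10 * D
... | yes large = large
... | no ¬large with m≤n⇒m<n∨m≡n (#hashBelow≤M M D)
...   | inj₁ t<M = ⊥-elim (<-irrefl refl (#hashBelow-≥ M D _ t<M (≰⇒> ¬large)))
...   | inj₂ t≡M = ⊥-elim (¬large (begin
          M ^ 10
        ≤⟨ m≤m*n (M ^ 10) D {{>-nonZero D>0}} ⟩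
          M ^ 10 * D
        ≡⟨ cong (λ t → t ^ 10 * D) (sym t≡M) ⟩
          #hashBelow M D ^ 10 * D ∎))
  where open ≤-Reasoning

^-distribʳ-* : ∀ m n k → (m * n) ^ k ≡ m ^ k * n ^ k
^-distribʳ-* m n zero    = refl
^-distribʳ-* m n (suc k) rewrite ^-distribʳ-* m n k = shuffle m n (m ^ k) (n ^ k)
  where
  shuffle : ∀ a b c d → a * b * (c * d) ≡ a * c * (b * d)
  shuffle = solve-∀

^-cancelʳ-≤ : ∀ k {m n} → m ^ suc k ≤ n ^ suc k → m ≤ n
^-cancelʳ-≤ k {m} {n} mᵏ≤nᵏ with m ≤? n
... | yes m≤n = m≤n
... | no  m≰n = ⊥-elim (<⇒≱ (^-monoˡ-< (suc k) (≰⇒> m≰n)) mᵏ≤nᵏ)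

m≤m^[1+n] : ∀ m n → 0 < m → m ≤ m ^ suc n
m≤m^[1+n] m n m>0 = m≤m*n m (m ^ n) {{m^n≢0 m n {{>-nonZero m>0}}}}

-- From Pr[join] = r/M, (r − 1)/M < d^(−0.1) and Pr[fail] ≤ (r − 2)/M:
-- Pr[fail or join] ≤ 2(r − 1)/M < 2 d^(−0.1).
joinsOrFails-arith : ∀ T F A M N r d → T ≤ F + A → A * M ≡ N * r → 0 < M → 0 < r →
  (r ∸ 1) ^ 10 * d < M ^ 10 → F * M + 2 * N ≤ N * r → T ^ 10 * d ≤ 2 ^ 10 * N ^ 10
joinsOrFails-arith T F A M N (suc r) d T≤F+A AM≡Nr M>0 _ last FM+2N≤Nr =
  *-cancelʳ-≤ _ _ (M ^ 10) {{m^n≢0 M 10 {{>-nonZero M>0}}}} (begin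
      T ^ 10 * d * M ^ 10
    ≡⟨ trans (swap (T ^ 10) d (M ^ 10)) (cong (_* d) (sym (^-distribʳ-* T M 10))) ⟩
      (T * M) ^ 10 * d
    ≤⟨ *-monoˡ-≤ d (^-monoˡ-≤ 10 TM≤2Nr) ⟩
      (2 * N * r) ^ 10 * d
    ≡⟨ cong (_* d) (trans (^-distribʳ-* (2 * N) r 10) (cong (_* r ^ 10) (^-distribʳ-* 2 N 10))) ⟩
      2 ^ 10 * N ^ 10 * r ^ 10 * d
    ≡⟨ *-assoc (2 ^ 10 * N ^ 10) (r ^ 10) d ⟩
      2 ^ 10 * N ^ 10 * (r ^ 10 * d)
    ≤⟨ *-monoʳ-≤ (2 ^ 10 * N ^ 10) (<⇒≤ last) ⟩
      2 ^ 10 * N ^ 10 * M ^ 10 ∎)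
  where
  open ≤-Reasoning
  swap : ∀ a b c → a * b * c ≡ a * c * b
  swap = solve-∀
  regroup₁ : ∀ N r FM → FM + N * suc r + N ≡ (FM + 2 * N) + N * r
  regroup₁ = solve-∀
  regroup₂ : ∀ N r → N * suc r + N * r ≡ 2 * N * r + N
  regroup₂ = solve-∀
  TM≤2Nr : T * M ≤ 2 * N * r
  TM≤2Nr = begin
      T * M
    ≤⟨ *-monoˡ-≤ M T≤F+A ⟩
      (F + A) * M
    ≡⟨ trans (*-distribʳ-+ M F A) (cong (F * M +_) AM≡Nr) ⟩
      F * M + N * suc r
    ≤⟨ +-cancelʳ-≤ N _ _ (begin
          F * M + N * suc r + N
        ≡⟨ regroup₁ N r (F * M) ⟩
          (F * M + 2 * N) + N * r
        ≤⟨ +-monoˡ-≤ (N * r) FM+2N≤Nr ⟩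
          N * suc r + N * r
        ≡⟨ regroup₂ N r ⟩
          2 * N * r + N ∎) ⟩
      2 * N * r ∎

-- Pr[fail] ≤ 2025 M / (s t) ≤ (t − 2)/M ≤ (r − 2)/M, with denominators cleared.
failureRate-arith : ∀ F s t r M N → F * (s * t) ≤ 2025 * (M * N) → t ≤ r → 4 ≤ t →
  4050 * (M * M) ≤ s * (t * t) → 0 < s → F * M + 2 * N ≤ N * r
failureRate-arith F s t r M N F≤ t≤r 4≤t 4050M²≤st² s>0 =
  *-cancelʳ-≤ _ _ (s * t) {{>-nonZero (*-mono-≤ s>0 (≤-trans (s≤s z≤n) 4≤t))}} (begin
      (F * M + 2 * N) * (s * t)
    ≡⟨ regroup₁ F M N (s * t) ⟩
      F * (s * t) * M + 2 * N * (s * t)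
    ≤⟨ +-monoˡ-≤ (2 * N * (s * t)) (*-monoˡ-≤ M F≤) ⟩
      2025 * (M * N) * M + 2 * N * (s * t)
    ≡⟨ regroup₂ M N (s * t) ⟩
      N * (2025 * (M * M) + 2 * (s * t))
    ≤⟨ *-monoʳ-≤ N (*-cancelˡ-≤ 2 doubled) ⟩
      N * (s * (t * t))
    ≡⟨ regroup₃ N s t ⟩
      N * t * (s * t)
    ≤⟨ *-monoˡ-≤ (s * t) (*-monoʳ-≤ N t≤r) ⟩
      N * r * (s * t) ∎)
  where
  open ≤-Reasoning
  regroup₁ : ∀ F M N st → (F * M + 2 * N) * st ≡ F * st * M + 2 * N * st
  regroup₁ = solve-∀
  regroup₂ : ∀ M N st → 2025 * (M * N) * M + 2 * N * st ≡ N * (2025 * (M * M) + 2 * st)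
  regroup₂ = solve-∀
  regroup₃ : ∀ N s t → N * (s * (t * t)) ≡ N * t * (s * t)
  regroup₃ = solve-∀
  regroup₄ : ∀ M s t → 2 * (2025 * (M * M) + 2 * (s * t)) ≡ 4050 * (M * M) + s * t * 4
  regroup₄ = solve-∀
  regroup₅ : ∀ s t → s * (t * t) + s * t * t ≡ 2 * (s * (t * t))
  regroup₅ = solve-∀
  doubled : 2 * (2025 * (M * M) + 2 * (s * t)) ≤ 2 * (s * (t * t))
  doubled = begin
      2 * (2025 * (M * M) + 2 * (s * t))
    ≡⟨ regroup₄ M s t ⟩
      4050 * (M * M) + s * t * 4
    ≤⟨ +-mono-≤ 4050M²≤st² (*-monoʳ-≤ (s * t) 4≤t) ⟩
      s * (t * t) + s * t * t
    ≡⟨ regroup₅ s t ⟩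
      2 * (s * (t * t)) ∎

-- X ≤ K < p^0.9 / 4 < (1.1 d)^0.9 / 4 while E X = s t / M ≥ (d/3) (6d)^(−0.1); the ratio of the
-- two bounds is about 0.977 < 44/45. The proof compares tenth powers.
45MX≤44st : ∀ X K p d s t M → X ≤ K → 4 ^ 10 * K ^ 10 < p ^ 9 → 10 * p < 11 * d → d < 3 * s →
  M ^ 10 ≤ t ^ 10 * (6 * d) → 0 < d → 45 * (M * X) ≤ 44 * (s * t)
45MX≤44st X K p d s t M X≤K few 10p<11d d<3s M≤t·6d d>0 =
  ^-cancelʳ-≤ 9 (*-cancelʳ-≤ _ _ (E * K₁ * d) {{>-nonZero (*-mono-≤ {1} {E * K₁} (≤ᵇ⇒≤ 1 (E * K₁) tt) d>0)}} (begin
      (45 * (M * X)) ^ 10 * (E * K₁ * d)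
    ≡⟨ cong (_* (E * K₁ * d)) (trans (^-distribʳ-* 45 (M * X) 10) (cong (45 ^ 10 *_) (^-distribʳ-* M X 10))) ⟩
      45 ^ 10 * (M ^ 10 * X ^ 10) * (E * K₁ * d)
    ≡⟨ regroup₁ (45 ^ 10) (M ^ 10) (X ^ 10) E K₁ d ⟩
      45 ^ 10 * M ^ 10 * K₁ * d * (E * X ^ 10)
    ≤⟨ *-monoʳ-≤ (45 ^ 10 * M ^ 10 * K₁ * d) EX¹⁰≤ ⟩
      45 ^ 10 * M ^ 10 * K₁ * d * (11 ^ 9 * d ^ 9)
    ≡⟨ regroup₂ (45 ^ 10) (M ^ 10) K₁ d (11 ^ 9) (d ^ 9) ⟩
      (45 ^ 10 * 11 ^ 9 * K₁) * (d ^ 10 * M ^ 10)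
    ≤⟨ *-mono-≤ (≤ᵇ⇒≤ (45 ^ 10 * 11 ^ 9 * K₁) (44 ^ 10 * E) tt) d¹⁰M¹⁰≤ ⟩
      44 ^ 10 * E * (K₁ * (s ^ 10 * t ^ 10 * d))
    ≡⟨ regroup₃ (44 ^ 10) E K₁ (s ^ 10) (t ^ 10) d ⟩
      44 ^ 10 * (s ^ 10 * t ^ 10) * (E * K₁ * d)
    ≡⟨ cong (_* (E * K₁ * d)) (sym (trans (^-distribʳ-* 44 (s * t) 10) (cong (44 ^ 10 *_) (^-distribʳ-* s t 10)))) ⟩
      (44 * (s * t)) ^ 10 * (E * K₁ * d) ∎))
  where
  open ≤-Reasoning
  E K₁ : ℕ
  E  = 10 ^ 9 * 4 ^ 10
  K₁ = 3 ^ 10 * 6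
  regroup₁ : ∀ a Mp Xp E K₁ d → a * (Mp * Xp) * (E * K₁ * d) ≡ a * Mp * K₁ * d * (E * Xp)
  regroup₁ = solve-∀
  regroup₂ : ∀ a Mp K₁ d c Dp → a * Mp * K₁ * d * (c * Dp) ≡ (a * c * K₁) * (d * Dp * Mp)
  regroup₂ = solve-∀
  regroup₃ : ∀ c E K₁ S T d → c * E * (K₁ * (S * T * d)) ≡ c * (S * T) * (E * K₁ * d)
  regroup₃ = solve-∀
  regroup₄ : ∀ a b c d → a * b * (c * (6 * d)) ≡ a * 6 * (b * c * d)
  regroup₄ = solve-∀
  EX¹⁰≤ : E * X ^ 10 ≤ 11 ^ 9 * d ^ 9
  EX¹⁰≤ = begin
      10 ^ 9 * 4 ^ 10 * X ^ 10
    ≡⟨ *-assoc (10 ^ 9) (4 ^ 10) (X ^ 10) ⟩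
      10 ^ 9 * (4 ^ 10 * X ^ 10)
    ≤⟨ *-monoʳ-≤ (10 ^ 9) (≤-trans (*-monoʳ-≤ (4 ^ 10) (^-monoˡ-≤ 10 X≤K)) (<⇒≤ few)) ⟩
      10 ^ 9 * p ^ 9
    ≡⟨ sym (^-distribʳ-* 10 p 9) ⟩
      (10 * p) ^ 9
    ≤⟨ ^-monoˡ-≤ 9 (<⇒≤ 10p<11d) ⟩
      (11 * d) ^ 9
    ≡⟨ ^-distribʳ-* 11 d 9 ⟩
      11 ^ 9 * d ^ 9 ∎
  d¹⁰M¹⁰≤ : d ^ 10 * M ^ 10 ≤ K₁ * (s ^ 10 * t ^ 10 * d)
  d¹⁰M¹⁰≤ = begin
      d ^ 10 * M ^ 10
    ≤⟨ *-mono-≤ (^-monoˡ-≤ 10 (<⇒≤ d<3s)) M≤t·6d ⟩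
      (3 * s) ^ 10 * (t ^ 10 * (6 * d))
    ≡⟨ cong (_* (t ^ 10 * (6 * d))) (^-distribʳ-* 3 s 10) ⟩
      3 ^ 10 * s ^ 10 * (t ^ 10 * (6 * d))
    ≡⟨ regroup₄ (3 ^ 10) (s ^ 10) (t ^ 10) d ⟩
      K₁ * (s ^ 10 * t ^ 10 * d) ∎

[m*m]^5≡m^10 : ∀ m → (m * m) ^ 5 ≡ m ^ 10
[m*m]^5≡m^10 m = trans (^-distribʳ-* m m 5) (sym (^-distribˡ-+-* m 5 5))

-- (s t / M) · (t / M) ≥ 4050, as s t / M ≳ d^0.9 / 3 and t / M ≳ (6d)^(−0.1) with d ≥ 10⁶.
4050M²≤st² : ∀ s t M d → d < 3 * s → M ^ 10 ≤ t ^ 10 * (6 * d) → 1000000 ≤ d → 4050 * (M * M) ≤ s * (t * t)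
4050M²≤st² s t M d d<3s M≤t·6d big =
  ^-cancelʳ-≤ 4 (*-cancelʳ-≤ _ _ (243 * 6 * d) {{>-nonZero (≤-trans (s≤s z≤n) (*-monoʳ-≤ (243 * 6) big))}} (begin
      (4050 * (M * M)) ^ 5 * (243 * 6 * d)
    ≡⟨ cong (_* (243 * 6 * d)) (trans (^-distribʳ-* 4050 (M * M) 5) (cong (4050 ^ 5 *_) ([m*m]^5≡m^10 M))) ⟩
      4050 ^ 5 * M ^ 10 * (243 * 6 * d)
    ≡⟨ regroup₁ (4050 ^ 5) (M ^ 10) d ⟩
      4050 ^ 5 * (243 * 6) * (d * M ^ 10)
    ≤⟨ *-monoˡ-≤ (d * M ^ 10) (≤-trans (≤ᵇ⇒≤ (4050 ^ 5 * (243 * 6)) (1000000 ^ 4) tt) (^-monoˡ-≤ 4 big)) ⟩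
      d ^ 4 * (d * M ^ 10)
    ≡⟨ regroup₂ (d ^ 4) d (M ^ 10) ⟩
      d ^ 5 * M ^ 10
    ≤⟨ *-mono-≤ (^-monoˡ-≤ 5 (<⇒≤ d<3s)) M≤t·6d ⟩
      (3 * s) ^ 5 * (t ^ 10 * (6 * d))
    ≡⟨ cong (_* (t ^ 10 * (6 * d))) (^-distribʳ-* 3 s 5) ⟩
      243 * s ^ 5 * (t ^ 10 * (6 * d))
    ≡⟨ regroup₃ (s ^ 5) (t ^ 10) d ⟩
      s ^ 5 * t ^ 10 * (243 * 6 * d)
    ≡⟨ cong (_* (243 * 6 * d)) (sym (trans (^-distribʳ-* s (t * t) 5) (cong (s ^ 5 *_) ([m*m]^5≡m^10 t)))) ⟩
      (s * (t * t)) ^ 5 * (243 * 6 * d) ∎))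
  where
  open ≤-Reasoning
  regroup₁ : ∀ c Mp d → c * Mp * (243 * 6 * d) ≡ c * (243 * 6) * (d * Mp)
  regroup₁ = solve-∀
  regroup₂ : ∀ d4 d Mp → d4 * (d * Mp) ≡ d * d4 * Mp
  regroup₂ = solve-∀
  regroup₃ : ∀ a T d → 243 * a * (T * (6 * d)) ≡ a * T * (243 * 6 * d)
  regroup₃ = solve-∀

4≤t : ∀ t M d → M ^ 10 ≤ t ^ 10 * (6 * d) → d * d ≤ M → 1000000 ≤ d → 4 ≤ t
4≤t t M d M≤t·6d d²≤M big with 4 ≤? t
... | yes 4≤t = 4≤t
... | no  4≰t = ⊥-elim (<⇒≱ t·6d<M M≤t·6d)
  where
  open ≤-Reasoning
  t·6d<M : t ^ 10 * (6 * d) < M ^ 10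
  t·6d<M = begin-strict
      t ^ 10 * (6 * d)
    ≤⟨ *-monoˡ-≤ (6 * d) (^-monoˡ-≤ 10 (≤-pred (≰⇒> 4≰t))) ⟩
      3 ^ 10 * (6 * d)
    ≡⟨ sym (*-assoc (3 ^ 10) 6 d) ⟩
      3 ^ 10 * 6 * d
    <⟨ *-monoˡ-< d {{>-nonZero (≤-trans (s≤s z≤n) big)}} (<ᵇ⇒< (3 ^ 10 * 6) 1000000 tt) ⟩
      1000000 * d
    ≤⟨ *-monoˡ-≤ d big ⟩
      d * d
    ≤⟨ d²≤M ⟩
      M
    ≤⟨ m≤m^[1+n] M 9 (≤-trans (≤-trans (s≤s z≤n) (*-mono-≤ big big)) d²≤M) ⟩
      M ^ 10 ∎

deg≤size : {m : ℕ} (G : Graph m) (v : Fin m) → deg G v ≤ m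
deg≤size {m} G v = ≤-trans (length-filter _ (allFin m)) (≤-reflexive (length-tabulate (λ i → i)))

deg²≤n^2 : {n m : ℕ} (G : Graph m) (v : Fin m) → m ≤ n → deg G v * deg G v ≤ n ^ 2
deg²≤n^2 {n} G v m≤n = *-mono-≤ d≤n (≤-trans d≤n (≤-reflexive (sym (*-identityʳ n))))
  where
  d≤n : deg G v ≤ n
  d≤n = ≤-trans (deg≤size G v) m≤n

module FailsOrJoins {m M : ℕ} (G : Graph m) (p : Fin m → ℕ) (H : List (Fin m → Fin M))
                    (indep : KWiseIndependent 101 H) (v : Fin m)
                    (d²≤M : deg G v * deg G v ≤ M) (C≤p : 2000000 ≤ p v) where

  d N r : ℕ
  d = deg G v
  N = length H
  r = #hashBelow M d

  fails : (Fin m → Fin M) → Bool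
  fails h = not (successful G p h v)

  #failsOrJoins #fails #joins : ℕ
  #failsOrJoins = countList (λ h → failsOrJoins G p h v) H
  #fails = ∑[ h ∈ H ] 𝟙 (fails h)
  #joins = ∑[ h ∈ H ] 𝟙 (joins G h v)

  near : Fin m → Bool
  near u = adj G v u ∧ (d ≤ᵇ 2 * deg G u) ∧ (deg G u ≤ᵇ 6 * d)

  slack sparse : Bool
  slack  = 11 * d ≤ᵇ 10 * p v
  sparse = 3 * nApprox G v ≤ᵇ d

  manyJoining : (Fin m → Fin M) → Bool
  manyJoining h = p v ^ 9 ≤ᵇ 4 ^ 10 * joiningNbrs G h v ^ 10

  successful-if : ∀ {h} → T slack ⊎ T sparse ⊎ T (manyJoining h) → T (successful G p h v)
  successful-if {h} = Equivalence.from (T-∨ {slack}) ∘ map₂ (Equivalence.from (T-∨ {sparse} {manyJoining h}))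

  open HitCount H indep near (hashBelow (6 * d)) using (s; t; X; concentration)

  nApprox≡s : nApprox G v ≡ s
  nApprox≡s = countList≡∑𝟙 near (allFin m)

  #failsOrJoins≤ : #failsOrJoins ≤ #fails + #joins
  #failsOrJoins≤ = begin
      #failsOrJoins
    ≡⟨ countList≡∑𝟙 _ H ⟩
      ∑[ h ∈ H ] 𝟙 (fails h ∨ joins G h v)
    ≤⟨ ∑-mono-≤ H (λ h → 𝟙-∨ (fails h) (joins G h v)) ⟩
      ∑[ h ∈ H ] (𝟙 (fails h) + 𝟙 (joins G h v))
    ≡⟨ ∑-distrib-+ _ _ H ⟩
      #fails + #joins ∎
    where open ≤-Reasoning

  bound-from-failures : 2 ≤ r → #fails * M + 2 * N ≤ N * r → #failsOrJoins ^ 10 * d ≤ 2 ^ 10 * N ^ 10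
  bound-from-failures 2≤r =
    joinsOrFails-arith #failsOrJoins #fails #joins M N r d #failsOrJoins≤ (∑-eval H indep v (𝟙 ∘ hashBelow d))
      (≤-trans (≤-trans (s≤s z≤n) 2≤r) (#hashBelow≤M M d)) r>0 (#hashBelow-last M d r>0)
    where
    r>0 : 0 < r
    r>0 = ≤-trans (s≤s z≤n) 2≤r

  2≤r : 2 ≤ d → 2 ≤ r
  2≤r 2≤d = #hashBelow-≥ M d 1 (≤-trans 2≤d d≤M) (begin-strict
      1 * d
    ≡⟨ *-identityˡ d ⟩
      d
    <⟨ <-≤-trans (m<m*n d d 2≤d) d²≤M ⟩
      M
    ≤⟨ m≤m^[1+n] M 9 (≤-trans d>0 d≤M) ⟩
      M ^ 10 ∎)
    where
    open ≤-Reasoning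
    d>0 : 0 < d
    d>0 = ≤-trans (s≤s z≤n) 2≤d
    instance
      d≢0 : NonZero d
      d≢0 = >-nonZero d>0
    d≤M : d ≤ M
    d≤M = ≤-trans (m≤m*n d d) d²≤M

  small-degree : d ≤ 1 → #failsOrJoins ^ 10 * d ≤ 2 ^ 10 * N ^ 10
  small-degree d≤1 = begin
      #failsOrJoins ^ 10 * d
    ≤⟨ *-mono-≤ (^-monoˡ-≤ 10 (length-filter _ H)) d≤1 ⟩
      N ^ 10 * 1
    ≡⟨ *-identityʳ (N ^ 10) ⟩
      N ^ 10
    ≤⟨ m≤n*m (N ^ 10) (2 ^ 10) ⟩
      2 ^ 10 * N ^ 10 ∎
    where open ≤-Reasoning

  always-successful : 2 ≤ d → (∀ h → T (successful G p h v)) → #failsOrJoins ^ 10 * d ≤ 2 ^ 10 * N ^ 10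
  always-successful 2≤d successful-h = bound-from-failures (2≤r 2≤d) (begin
      #fails * M + 2 * N
    ≡⟨ cong (λ F → F * M + 2 * N) (trans (∑-cong H (λ h → 𝟙-not (successful-h h))) (∑-zero H)) ⟩
      2 * N
    ≡⟨ *-comm 2 N ⟩
      N * 2
    ≤⟨ *-monoʳ-≤ N (2≤r 2≤d) ⟩
      N * r ∎)
    where
    open ≤-Reasoning
    𝟙-not : ∀ {b} → T b → 𝟙 (not b) ≡ 0
    𝟙-not {true} _ = refl

  module _ (10p<11d : 10 * p v < 11 * d) (d<3s : d < 3 * s) where

    large-degree : 1000000 ≤ d
    large-degree with 1000000 ≤? d
    ... | yes large = large
    ... | no  small = ⊥-elim (<⇒≱ 10p<11d (begin
        11 * d
      ≤⟨ *-monoʳ-≤ 11 (≤-pred (≰⇒> small)) ⟩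
        11 * 999999
      ≤⟨ ≤ᵇ⇒≤ (11 * 999999) (10 * 2000000) tt ⟩
        10 * 2000000
      ≤⟨ *-monoʳ-≤ 10 C≤p ⟩
        10 * p v ∎))
      where open ≤-Reasoning

    d>0 : 0 < d
    d>0 = ≤-trans (s≤s z≤n) large-degree

    s>0 : 0 < s
    s>0 with s
    ... | zero  = ⊥-elim (<⇒≱ d<3s z≤n)
    ... | suc _ = s≤s z≤n

    M≤t·6d : M ^ 10 ≤ t ^ 10 * (6 * d)
    M≤t·6d = #hashBelow-large M (6 * d) (≤-trans d>0 (m≤n*m d 6))

    4≤t′ : 4 ≤ t
    4≤t′ = 4≤t t M d M≤t·6d d²≤M large-degree

    X≤joiningNbrs : ∀ h → X h ≤ joiningNbrs G h v
    X≤joiningNbrs h = ≤-trans (∑-mono-≤ (allFin m) (λ u → 𝟙-∧-mono (near-joins u)))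
                              (≤-reflexive (sym (countList≡∑𝟙 _ (allFin m))))
      where
      near-joins : ∀ u → T (near u) → T (hashBelow (6 * d) (h u)) → T (adj G v u ∧ joins G h u)
      near-joins u near-u below = Equivalence.from T-∧
        (proj₁ adj×close , hashBelow-antitone {M} {deg G u} {6 * d} {h u} deg≤6d below)
        where
        adj×close : T (adj G v u) × T ((d ≤ᵇ 2 * deg G u) ∧ (deg G u ≤ᵇ 6 * d))
        adj×close = Equivalence.to (T-∧ {adj G v u}) near-u
        deg≤6d : deg G u ≤ 6 * d
        deg≤6d = ≤ᵇ⇒≤ (deg G u) (6 * d) (proj₂ (Equivalence.to T-∧ (proj₂ adj×close)))

    few-joining : ∀ h → T (fails h) → 4 ^ 10 * joiningNbrs G h v ^ 10 < p v ^ 9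
    few-joining h fails-h = ≰⇒> (λ many →
      subst T (Equivalence.to T-not-≡ fails-h) (successful-if {h} (inj₂ (inj₂ (≤⇒≤ᵇ many)))))

    failures-rare : #fails * M + 2 * N ≤ N * r
    failures-rare = failureRate-arith #fails s t r M N
      (concentration fails (*-mono-≤ s>0 (≤-trans (s≤s z≤n) 4≤t′))
        (λ h fails-h → 45MX≤44st (X h) (joiningNbrs G h v) (p v) d s t M
                         (X≤joiningNbrs h) (few-joining h fails-h) 10p<11d d<3s M≤t·6d d>0))
      (#hashBelow-antitone M (m≤n*m d 6)) 4≤t′ (4050M²≤st² s t M d d<3s M≤t·6d large-degree) s>0

  bound : #failsOrJoins ^ 10 * d ≤ 2 ^ 10 * N ^ 10
  bound = by-cases (2 ≤? d) (11 * d ≤? 10 * p v) (3 * s ≤? d)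
    where
    by-cases : Dec (2 ≤ d) → Dec (11 * d ≤ 10 * p v) → Dec (3 * s ≤ d) → #failsOrJoins ^ 10 * d ≤ 2 ^ 10 * N ^ 10
    by-cases (no  d≱2) _ _ = small-degree (≤-pred (≰⇒> d≱2))
    by-cases (yes 2≤d) (yes slack′) _ = always-successful 2≤d (λ h → successful-if {h} (inj₁ (≤⇒≤ᵇ slack′)))
    by-cases (yes 2≤d) (no ¬slack′) (yes sparse′) = always-successful 2≤d (λ h → successful-if {h}
      (inj₂ (inj₁ (≤⇒≤ᵇ (subst (λ a → 3 * a ≤ d) (sym nApprox≡s) sparse′)))))
    by-cases (yes 2≤d) (no ¬slack′) (no ¬sparse′) =
      bound-from-failures (2≤r 2≤d) (failures-rare (≰⇒> ¬slack′) (≰⇒> ¬sparse′))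

mainTheorem7 : ∃ λ (C : ℕ) → ∃ λ (c : ℕ) →
  ∀ (n m : ℕ) → m ≤ n → (G : Graph m) → (p : Fin m → ℕ) →
  (∀ v → deg G v + 1 ≤ p v) →
  ∀ (M : ℕ) → n ^ c ≤ M →
  (H : List (Fin m → Fin M)) → 1 ≤ length H → KWiseIndependent 101 H →
  ∀ (v : Fin m) → C ≤ p v →
    countList (λ h → failsOrJoins G p h v) H ^ 10 * deg G v
      ≤ 2 ^ 10 * length H ^ 10
mainTheorem7 = 2000000 , 2 , λ n m m≤n G p _ M n²≤M H _ indep v C≤p →
  FailsOrJoins.bound G p H indep v (≤-trans (deg²≤n^2 G v m≤n) n²≤M) C≤p
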